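{- For every integer $g\ge 0$, the sequences $R_g=(R_{g,n})_{n\ge 1}$ and $r_g=(r_{g,n})_{n\ge1}$ define elements of $\mathcal{W}$.
   Context: Let $\mathbb{C}_n[\mathbf{w}]$ be the ring of polynomials in commuting variables $w_{ij}$, $1\le i\ne j\le n$, modulo $w_{ij}=w_{ji}$. The group $S_n$ acts by permuting indices. Let $\pi_n:\mathbb{C}_n[\mathbf{w}]\to\mathbb{C}_{n-1}[\mathbf{w}]$ be the substitution $w_{1n}=\dots=w_{n-1,n}=0$. The algebra $\mathcal{W}$ is the projective limit of the spaces of $S_n$-invariants in $\mathbb{C}_n[\mathbf{w}]$ with respect to the maps $\pi_n$. Concretely, a family $(P_n)_{n\ge1}$ with $P_n\in\mathbb{C}_n[\mathbf{w}]$ is an element of $\mathcal{W}$ if: - each $P_n$ is $S_n$-invariant; - the degrees of the $P_n$ are uniformly bounded; - $\pi_n(P_n)=P_{n-1}$ for all $n$. $A_n$ is the $n\times n$ matrix with $(A_n)_{ii}=\sum_{j\ne i}w_{ij}$ and $(A_n)_{ij}=-w_{ij}$ for $i\ne j$. Let $\phi(t)=\sinh(t/2)/(t/2)$. Define $$r_n=\mathrm{Tr}\ln\phi(A_n)=\sum_{g\ge0}\frac{B_{2g}}{(2g)!\,(2g)}\mathrm{Tr}A_n^{2g},$$ where $B_{2g}$ are the Bernoulli numbers and the $g=0$ term is $0$. Also define $R_n=\exp(r_n)=\det\phi(A_n)$. Then $r_{g,n}$ and $R_{g,n}$ are the homogeneous parts of degree $2g$ of $r_n$ and $R_n$, respectively.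 -}

module Defs where

open import Data.Nat as ℕ using (ℕ; zero; suc; _<_; _≤_)
open import Data.Nat.Combinatorics using (_C_)
open import Data.Nat using (_!)
open import Data.Integer using (+_)
open import Data.Fin using (Fin; toℕ; inject₁; fromℕ)
open import Data.Fin.Permutation using (Permutation′; _⟨$⟩ʳ_)
open import Data.List using (List; []; _∷_; [_]; _++_; map; concatMap; foldr; foldl; allFin; filterᵇ; upTo; zip; length)
open import Data.Bool.ListAction using (and)
open import Data.Bool using (Bool; true; false; if_then_else_; _∧_; _∨_)
open import Data.Product using (_×_; _,_; ∃)
open import Data.Rational as ℚ using (ℚ; 0ℚ; 1ℚ; _/_)
open import Relation.Binary.PropositionalEquality using (_≡_)

-- A monomial is an exponent table  m : Fin n → Fin n → ℕ ; only the
-- entries m i j with toℕ i < toℕ j are meaningful (exponent of w_ij = w_ji);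
-- the other entries are ignored everywhere.

Mon : ℕ → Set
Mon n = Fin n → Fin n → ℕ

pairs : (n : ℕ) → List (Fin n × Fin n)
pairs n = concatMap (λ i → concatMap (λ j → if toℕ i ℕ.<ᵇ toℕ j then [ (i , j) ] else []) (allFin n)) (allFin n)

monEq : {n : ℕ} → Mon n → Mon n → Bool
monEq {n} m m′ = and (map (λ { (i , j) → m i j ℕ.≡ᵇ m′ i j }) (pairs n))

totalDeg : {n : ℕ} → Mon n → ℕ
totalDeg {n} m = foldr ℕ._+_ 0 (map (λ { (i , j) → m i j }) (pairs n))

Poly : ℕ → Set
Poly n = List (ℚ × Mon n)

coeff : {n : ℕ} → Poly n → Mon n → ℚ
coeff p m = foldr (λ { (c , m′) acc → if monEq m′ m then c ℚ.+ acc else acc }) 0ℚ p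

-- equality in ℚ[w_ij] : equality of all coefficients
infix 4 _≈P_
_≈P_ : {n : ℕ} → Poly n → Poly n → Set
p ≈P q = ∀ m → coeff p m ≡ coeff q m

zeroP : {n : ℕ} → Poly n
zeroP = []

oneMon : {n : ℕ} → Mon n
oneMon _ _ = 0

constP : {n : ℕ} → ℚ → Poly n
constP c = [ (c , oneMon) ]

infixl 6 _+P_
_+P_ : {n : ℕ} → Poly n → Poly n → Poly n
_+P_ = _++_

scaleP : {n : ℕ} → ℚ → Poly n → Poly n
scaleP c = map (λ { (d , m) → (c ℚ.* d , m) })

infixl 7 _*P_
_*P_ : {n : ℕ} → Poly n → Poly n → Poly n
p *P q = concatMap (λ { (c , m) → map (λ { (d , m′) → (c ℚ.* d , λ i j → m i j ℕ.+ m′ i j) }) q }) p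

sumP : {n : ℕ} → List (Poly n) → Poly n
sumP = foldr _+P_ zeroP

powP : {n : ℕ} → Poly n → ℕ → Poly n
powP p zero = constP 1ℚ
powP p (suc k) = p *P powP p k

var : {n : ℕ} → Fin n → Fin n → Poly n
var i j = [ (1ℚ , (λ a b → if ((toℕ a ℕ.≡ᵇ toℕ i) ∧ (toℕ b ℕ.≡ᵇ toℕ j)) ∨ ((toℕ a ℕ.≡ᵇ toℕ j) ∧ (toℕ b ℕ.≡ᵇ toℕ i)) then 1 else 0)) ]

homPart : {n : ℕ} → ℕ → Poly n → Poly n
homPart d = filterᵇ (λ { (_ , m) → totalDeg m ℕ.≡ᵇ d })

Mat : ℕ → Set
Mat n = Fin n → Fin n → Poly n

_·M_ : {n : ℕ} → Mat n → Mat n → Mat n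
_·M_ {n} M N i j = sumP (map (λ k → M i k *P N k j) (allFin n))

idM : {n : ℕ} → Mat n
idM i j = if toℕ i ℕ.≡ᵇ toℕ j then constP 1ℚ else zeroP

powM : {n : ℕ} → Mat n → ℕ → Mat n
powM M zero = idM
powM M (suc k) = M ·M powM M k

trace : {n : ℕ} → Mat n → Poly n
trace {n} M = sumP (map (λ i → M i i) (allFin n))

A : (n : ℕ) → Mat n
A n i j = if toℕ i ℕ.≡ᵇ toℕ j
          then sumP (map (λ k → if toℕ k ℕ.≡ᵇ toℕ i then zeroP else var i k) (allFin n))
          else scaleP (ℚ.- 1ℚ) (var i j)

fromℕℚ : ℕ → ℚ
fromℕℚ k = (+ k) / 1

-- 1/k  (with 1/0 := 0, only used for k ≠ 0)
invℕ : ℕ → ℚ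
invℕ zero = 0ℚ
invℕ (suc k) = (+ 1) / suc k

-- Bernoulli numbers: B_0 = 1, B_m = -1/(m+1) Σ_{k<m} C(m+1,k) B_k
-- (so B_1 = -1/2; only even-indexed ones are used)
bernStep : ℕ → List ℚ → ℚ
bernStep m bs = ℚ.- (invℕ (suc m) ℚ.* foldr ℚ._+_ 0ℚ
                   (map (λ { (k , b) → fromℕℚ (suc m C k) ℚ.* b }) (zip (upTo (length bs)) bs)))

bernUpTo : ℕ → List ℚ
bernUpTo zero = [ 1ℚ ]
bernUpTo (suc m) = bernUpTo m ++ [ bernStep (suc m) (bernUpTo m) ]

bernoulli : ℕ → ℚ
bernoulli m = foldl (λ _ x → x) 0ℚ (bernUpTo m)

-- r_n = Σ_{h ≥ 1} B_{2h}/((2h)! 2h) Tr A_n^{2h}, truncated at h ≤ g.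
-- Terms with h > g are homogeneous of degree 2h > 2g, so they do not
-- affect the degree-2g part of r_n or of exp(r_n).

rCoeff : ℕ → ℚ
rCoeff h = bernoulli (2 ℕ.* h) ℚ.* invℕ (((2 ℕ.* h) !) ℕ.* (2 ℕ.* h))

rTrunc : ℕ → (n : ℕ) → Poly n
rTrunc g n = sumP (map (λ h → scaleP (rCoeff (suc h)) (trace (powM (A n) (2 ℕ.* suc h)))) (upTo g))

r : ℕ → (n : ℕ) → Poly n
r g n = homPart (2 ℕ.* g) (rTrunc g n)

-- R_{g,n} : homogeneous part of degree 2g of R_n = exp(r_n) = Σ_k r_n^k / k!
-- (only k ≤ g contributes, since r_n has no terms of degree < 2)
R : ℕ → (n : ℕ) → Poly n
R g n = homPart (2 ℕ.* g) (sumP (map (λ k → scaleP (invℕ (k !)) (powP (rTrunc g n) k)) (upTo (suc g))))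

symExp : {n : ℕ} → Mon n → Fin n → Fin n → ℕ
symExp m i j = if toℕ i ℕ.<ᵇ toℕ j then m i j else m j i

-- σ · ∏ w_ij^{e_ij} = ∏ w_{σ i σ j}^{e_ij}  (exponent at {a,b} becomes e_{σa σb})
act : {n : ℕ} → Permutation′ n → Poly n → Poly n
act σ = map (λ { (c , m) → (c , λ a b → symExp m (σ ⟨$⟩ʳ a) (σ ⟨$⟩ʳ b)) })

-- π_{n+1} : ℚ_{n+1}[w] → ℚ_n[w],  w_{i,n+1} ↦ 0
proj : {n : ℕ} → Poly (suc n) → Poly n
proj {n} p = map (λ { (c , m) → (c , λ i j → m (inject₁ i) (inject₁ j)) })
               (filterᵇ (λ { (_ , m) → and (map (λ i → m (inject₁ i) (fromℕ n) ℕ.≡ᵇ 0) (allFin n)) }) p)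

Invariant : {n : ℕ} → Poly n → Set
Invariant {n} p = ∀ (σ : Permutation′ n) → act σ p ≈P p

-- (P_n)_{n ≥ 1} is an element of 𝒲  (the value at n = 0 is ignored)
InW : ((n : ℕ) → Poly n) → Set
InW P = (∀ n → 1 ≤ n → Invariant (P n))
      × (∃ λ D → ∀ n → 1 ≤ n → ∀ (m : Mon n) → D < totalDeg m → coeff (P n) m ≡ 0ℚ)
      × (∀ n → 1 ≤ n → proj (P (suc n)) ≈P P n)

module Submission where

-- Both structure maps of 𝒲, relabelling the indices by σ ∈ S_n and the substitution
-- w_{1,n+1} = … = w_{n,n+1} = 0, act on polynomials monomial by monomial. So they are ring
-- homomorphisms that preserve the degree of every monomial they keep, and they commute with
-- taking homogeneous parts. Relabelling turns A_n into A_n with rows and columns permuted by σ⁻¹;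
-- the substitution turns A_{n+1} into A_n bordered by a row and a column that vanish. Either way
-- Tr A^k (k ≥ 1) is preserved, hence so are r_n and R_n, which are fixed polynomial expressions in
-- these traces, and so are their parts r_{g,n} and R_{g,n} of degree 2g, which bounds the degrees.

open import Defs
open import Algebra.Bundles using (CommutativeMonoid)
open import Algebra.Structures using (IsCommutativeMonoid)
import Algebra.Properties.CommutativeMonoid.Sum
import Algebra.Properties.CommutativeSemigroup
open import Data.Bool using (Bool; true; false; if_then_else_; _∧_; _∨_; T)
import Data.Bool.Properties as 𝔹
open import Data.Fin as Fin using (Fin; toℕ; inject₁; fromℕ)
open import Data.Fin.Permutation using (Permutation′; _⟨$⟩ʳ_; _⟨$⟩ˡ_; inverseˡ; inverseʳ; flip)
open import Data.Fin.Properties using (toℕ-injective; toℕ-inject₁; toℕ-fromℕ; toℕ<n; inject₁-injective; fromℕ≢inject₁)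
open import Data.List using (List; []; _∷_; [_]; _++_; map; concatMap; foldr; allFin; filterᵇ; upTo; tabulate)
open import Data.List.Membership.Propositional using (_∈_)
open import Data.List.Membership.Propositional.Properties using (∈-allFin)
open import Data.List.Properties using (map-∘)
open import Data.List.Relation.Unary.Any using (here; there)
open import Data.Nat as ℕ using (ℕ; zero; suc; _<_; _!)
import Data.Nat.Properties as ℕₚ
open import Data.Product using (_×_; _,_)
open import Data.Rational as ℚ using (ℚ; 0ℚ; 1ℚ)
import Data.Rational.Properties as ℚₚ
open import Function using (_∘_)
open import Function.Bundles using (mk⇔)
open import Relation.Binary using (IsEquivalence; Setoid; tri<; tri≈; tri>)
open import Relation.Binary.PropositionalEquality hiding ([_])
import Relation.Binary.Reasoning.Setoid as SetoidReasoning
open import Relation.Nullary using (¬_; yes; no)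
open import Relation.Nullary.Decidable using (does-⇔; dec-true; dec-false)

module ListSum {C : Set} {_∙_ : C → C → C} {ε : C} (isCM : IsCommutativeMonoid _≡_ _∙_ ε) where

  open IsCommutativeMonoid isCM using (assoc; identityˡ)

  commutativeMonoid : CommutativeMonoid _ _
  commutativeMonoid = record { isCommutativeMonoid = isCM }

  module Fin∑ = Algebra.Properties.CommutativeMonoid.Sum commutativeMonoid
  open Algebra.Properties.CommutativeSemigroup (CommutativeMonoid.commutativeSemigroup commutativeMonoid)
    using (interchange)

  ∑ : {X : Set} → (X → C) → List X → C
  ∑ f xs = foldr _∙_ ε (map f xs)

  private variable
    X Y : Set
    f g : X → C

  ∑-cong : (∀ x → f x ≡ g x) → ∀ xs → ∑ f xs ≡ ∑ g xs
  ∑-cong f≗g []       = refl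
  ∑-cong f≗g (x ∷ xs) = cong₂ _∙_ (f≗g x) (∑-cong f≗g xs)

  ∑-identity : (∀ x → f x ≡ ε) → ∀ xs → ∑ f xs ≡ ε
  ∑-identity f≗ε []       = refl
  ∑-identity f≗ε (x ∷ xs) = trans (cong₂ _∙_ (f≗ε x) (∑-identity f≗ε xs)) (identityˡ ε)

  ∑-distrib : ∀ (f g : X → C) xs → ∑ (λ x → f x ∙ g x) xs ≡ ∑ f xs ∙ ∑ g xs
  ∑-distrib f g []       = sym (identityˡ ε)
  ∑-distrib f g (x ∷ xs) = trans (cong (_ ∙_) (∑-distrib f g xs)) (interchange _ _ _ _)

  ∑-++ : ∀ (f : X → C) xs ys → ∑ f (xs ++ ys) ≡ ∑ f xs ∙ ∑ f ys
  ∑-++ f []       ys = sym (identityˡ _)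
  ∑-++ f (x ∷ xs) ys = trans (cong (f x ∙_) (∑-++ f xs ys)) (sym (assoc _ _ _))

  ∑-map : ∀ (f : Y → C) (g : X → Y) xs → ∑ f (map g xs) ≡ ∑ (f ∘ g) xs
  ∑-map f g xs = cong (foldr _∙_ ε) (sym (map-∘ xs))

  ∑-concatMap : ∀ (f : Y → C) (g : X → List Y) xs → ∑ f (concatMap g xs) ≡ ∑ (λ x → ∑ f (g x)) xs
  ∑-concatMap f g []       = refl
  ∑-concatMap f g (x ∷ xs) = trans (∑-++ f (g x) (concatMap g xs)) (cong (_ ∙_) (∑-concatMap f g xs))

  ∑-filterᵇ : ∀ (P : X → Bool) (f : X → C) xs → ∑ f (filterᵇ P xs) ≡ ∑ (λ x → if P x then f x else ε) xs
  ∑-filterᵇ P f []       = refl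
  ∑-filterᵇ P f (x ∷ xs) with P x
  ... | true  = cong (f x ∙_) (∑-filterᵇ P f xs)
  ... | false = trans (∑-filterᵇ P f xs) (sym (identityˡ _))

  ∑-if : ∀ b (f : X → C) xs → ∑ (λ x → if b then f x else ε) xs ≡ (if b then ∑ f xs else ε)
  ∑-if true  f xs = refl
  ∑-if false f xs = ∑-identity (λ _ → refl) xs

  ∑-comm : ∀ (F : X → Y → C) xs ys → ∑ (λ x → ∑ (F x) ys) xs ≡ ∑ (λ y → ∑ (λ x → F x y) xs) ys
  ∑-comm F []       ys = sym (∑-identity (λ _ → refl) ys)
  ∑-comm F (x ∷ xs) ys = trans (cong (_ ∙_) (∑-comm F xs ys)) (sym (∑-distrib (F x) _ ys))

  ∑-tabulate : ∀ {n} (f : X → C) (g : Fin n → X) → ∑ f (tabulate g) ≡ Fin∑.sum (f ∘ g)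
  ∑-tabulate {n = zero}  f g = refl
  ∑-tabulate {n = suc n} f g = cong (f (g Fin.zero) ∙_) (∑-tabulate f (g ∘ Fin.suc))

  ∑-allFin : ∀ {n} (f : Fin n → C) → ∑ f (allFin n) ≡ Fin∑.sum f
  ∑-allFin f = ∑-tabulate f (λ i → i)

module ℚ∑ = ListSum ℚₚ.+-0-isCommutativeMonoid
module ℕ∑ = ListSum ℕₚ.+-0-isCommutativeMonoid
module ∧∑ = ListSum 𝔹.∧-isCommutativeMonoid
module ℚΣ = ℚ∑.Fin∑
module ℕΣ = ℕ∑.Fin∑

open ℚ∑ using (∑)

private variable
  a b n : ℕ
  X : Set

∑-*ˡ : ∀ c (f : X → ℚ) xs → ∑ (λ x → c ℚ.* f x) xs ≡ c ℚ.* ∑ f xs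
∑-*ˡ c f []       = sym (ℚₚ.*-zeroʳ c)
∑-*ˡ c f (x ∷ xs) = trans (cong (c ℚ.* f x ℚ.+_) (∑-*ˡ c f xs)) (sym (ℚₚ.*-distribˡ-+ c _ _))

if-*ˡ : ∀ b c d → (if b then c ℚ.* d else 0ℚ) ≡ c ℚ.* (if b then d else 0ℚ)
if-*ˡ true  c d = refl
if-*ˡ false c d = sym (ℚₚ.*-zeroʳ c)

T-from : ∀ {b} → b ≡ true → T b
T-from refl = _

infix 4 _≗ₘ_
_≗ₘ_ : Mon n → Mon n → Set
m ≗ₘ m′ = ∀ i j → m i j ≡ m′ i j

infixl 7 _*ₘ_
_*ₘ_ : Mon n → Mon n → Mon n
(m *ₘ m′) i j = m i j ℕ.+ m′ i j

_∣ₘ_ : Mon n → Mon n → Bool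
_∣ₘ_ {n} m₁ m = ∧∑.∑ (λ (i , j) → m₁ i j ℕ.≤ᵇ m i j) (pairs n)

-- truncated subtraction: meaningful only when m₁ ∣ₘ m
_/ₘ_ : Mon n → Mon n → Mon n
(m /ₘ m₁) i j = m i j ℕ.∸ m₁ i j

monEq-congˡ : {m₁ m₂ : Mon n} → m₁ ≗ₘ m₂ → ∀ m → monEq m₁ m ≡ monEq m₂ m
monEq-congˡ {n} m₁≗m₂ m = ∧∑.∑-cong (λ (i , j) → cong (ℕ._≡ᵇ m i j) (m₁≗m₂ i j)) (pairs n)

all-cong-under : ∀ (P f g : X → Bool) → (∀ x → P x ≡ true → f x ≡ g x) →
                 ∀ xs → ∧∑.∑ P xs ≡ true → ∧∑.∑ f xs ≡ ∧∑.∑ g xs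
all-cong-under P f g f≗g []       _ = refl
all-cong-under P f g f≗g (x ∷ xs) Pxs with P x in Px
... | true = cong₂ _∧_ (f≗g x Px) (all-cong-under P f g f≗g xs Pxs)

all-false-under : ∀ (P f : X → Bool) → (∀ x → P x ≡ false → f x ≡ false) →
                  ∀ xs → ∧∑.∑ P xs ≡ false → ∧∑.∑ f xs ≡ false
all-false-under P f f⇒ (x ∷ xs) Pxs with P x in Px
... | true  = trans (cong (f x ∧_) (all-false-under P f f⇒ xs Pxs)) (𝔹.∧-zeroʳ (f x))
... | false = cong (_∧ ∧∑.∑ f xs) (f⇒ x Px)

+-≡ᵇ-shift : ∀ a b c → (a ℕ.≤ᵇ c) ≡ true → (a ℕ.+ b ℕ.≡ᵇ c) ≡ (b ℕ.≡ᵇ c ℕ.∸ a)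
+-≡ᵇ-shift a b c a≤ᵇc = does-⇔ (mk⇔ (λ e → trans (sym (ℕₚ.m+n∸m≡n a b)) (cong (ℕ._∸ a) e))
                                    (λ e → trans (cong (a ℕ.+_) e) (ℕₚ.m+[n∸m]≡n a≤c)))
                               (a ℕ.+ b ℕ.≟ c) (b ℕ.≟ c ℕ.∸ a)
  where a≤c = ℕₚ.≤ᵇ⇒≤ a c (T-from a≤ᵇc)

+-≡ᵇ-≰ : ∀ a b c → (a ℕ.≤ᵇ c) ≡ false → (a ℕ.+ b ℕ.≡ᵇ c) ≡ false
+-≡ᵇ-≰ a b c a≰ᵇc =
  dec-false (a ℕ.+ b ℕ.≟ c) (λ e → subst T a≰ᵇc (ℕₚ.≤⇒≤ᵇ (subst (a ℕ.≤_) e (ℕₚ.m≤m+n a b))))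

monEq-*ₘ : ∀ {m₁ m : Mon n} → (m₁ ∣ₘ m) ≡ true → ∀ u → monEq (m₁ *ₘ u) m ≡ monEq u (m /ₘ m₁)
monEq-*ₘ {n} {m₁} {m} m₁∣m u =
  all-cong-under _ _ _ (λ (i , j) → +-≡ᵇ-shift (m₁ i j) (u i j) (m i j)) (pairs n) m₁∣m

monEq-*ₘ-∤ : ∀ {m₁ m : Mon n} → (m₁ ∣ₘ m) ≡ false → ∀ u → monEq (m₁ *ₘ u) m ≡ false
monEq-*ₘ-∤ {n} {m₁} {m} m₁∤m u =
  all-false-under _ _ (λ (i , j) → +-≡ᵇ-≰ (m₁ i j) (u i j) (m i j)) (pairs n) m₁∤m

all-≡ᵇ⇒∑≡ : ∀ (f g : X → ℕ) xs → ∧∑.∑ (λ x → f x ℕ.≡ᵇ g x) xs ≡ true → ℕ∑.∑ f xs ≡ ℕ∑.∑ g xs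
all-≡ᵇ⇒∑≡ f g []       _  = refl
all-≡ᵇ⇒∑≡ f g (x ∷ xs) eq with f x ℕ.≡ᵇ g x in e
... | true = cong₂ ℕ._+_ (ℕₚ.≡ᵇ⇒≡ _ _ (T-from e)) (all-≡ᵇ⇒∑≡ f g xs eq)

monEq⇒totalDeg≡ : ∀ {m m′ : Mon n} → monEq m m′ ≡ true → totalDeg m ≡ totalDeg m′
monEq⇒totalDeg≡ {n} {m} {m′} = all-≡ᵇ⇒∑≡ (λ (i , j) → m i j) (λ (i , j) → m′ i j) (pairs n)

termCoeff : ℚ × Mon n → Mon n → ℚ
termCoeff (c , m′) m = if monEq m′ m then c else 0ℚ

termCoeff-cong : ∀ {c d} {m₁ m₂ : Mon n} → c ≡ d → m₁ ≗ₘ m₂ → ∀ m → termCoeff (c , m₁) m ≡ termCoeff (d , m₂) m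
termCoeff-cong {d = d} refl m₁≗m₂ m = 𝔹.if-cong (monEq-congˡ m₁≗m₂ m)

infixl 7 _*ₜ_
_*ₜ_ : ℚ × Mon n → ℚ × Mon n → ℚ × Mon n
(c , m) *ₜ (d , m′) = (c ℚ.* d , m *ₘ m′)

coeff-∑ : ∀ (p : Poly n) m → coeff p m ≡ ∑ (λ t → termCoeff t m) p
coeff-∑ []             m = refl
coeff-∑ ((c , m′) ∷ p) m with monEq m′ m
... | true  = cong (c ℚ.+_) (coeff-∑ p m)
... | false = trans (coeff-∑ p m) (sym (ℚₚ.+-identityˡ _))

coeff-+P : ∀ (p q : Poly n) m → coeff (p +P q) m ≡ coeff p m ℚ.+ coeff q m
coeff-+P p q m = begin
  coeff (p +P q) m                                          ≡⟨ coeff-∑ (p +P q) m ⟩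
  ∑ (λ t → termCoeff t m) (p ++ q)                          ≡⟨ ℚ∑.∑-++ _ p q ⟩
  ∑ (λ t → termCoeff t m) p ℚ.+ ∑ (λ t → termCoeff t m) q  ≡⟨ cong₂ ℚ._+_ (coeff-∑ p m) (coeff-∑ q m) ⟨
  coeff p m ℚ.+ coeff q m                                   ∎
  where open ≡-Reasoning

coeff-sumP : ∀ (F : X → Poly n) xs m → coeff (sumP (map F xs)) m ≡ ∑ (λ x → coeff (F x) m) xs
coeff-sumP F []       m = refl
coeff-sumP F (x ∷ xs) m = trans (coeff-+P (F x) _ m) (cong (coeff (F x) m ℚ.+_) (coeff-sumP F xs m))

coeff-scaleP : ∀ c (p : Poly n) m → coeff (scaleP c p) m ≡ c ℚ.* coeff p m
coeff-scaleP c p m = begin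
  coeff (scaleP c p) m                                  ≡⟨ coeff-∑ (scaleP c p) m ⟩
  ∑ (λ t → termCoeff t m) (scaleP c p)                  ≡⟨ ℚ∑.∑-map _ _ p ⟩
  ∑ (λ (d , m′) → if monEq m′ m then c ℚ.* d else 0ℚ) p ≡⟨ ℚ∑.∑-cong (λ (d , m′) → if-*ˡ (monEq m′ m) c d) p ⟩
  ∑ (λ t → c ℚ.* termCoeff t m) p                       ≡⟨ ∑-*ˡ c _ p ⟩
  c ℚ.* ∑ (λ t → termCoeff t m) p                       ≡⟨ cong (c ℚ.*_) (coeff-∑ p m) ⟨
  c ℚ.* coeff p m                                       ∎
  where open ≡-Reasoning

coeff-*P-double : ∀ (p q : Poly n) m → coeff (p *P q) m ≡ ∑ (λ t → ∑ (λ u → termCoeff (t *ₜ u) m) q) p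
coeff-*P-double p q m = begin
  coeff (p *P q) m                                        ≡⟨ coeff-∑ (p *P q) m ⟩
  ∑ (λ t → termCoeff t m) (p *P q)                        ≡⟨ ℚ∑.∑-concatMap _ _ p ⟩
  ∑ (λ t → ∑ (λ t′ → termCoeff t′ m) (map (t *ₜ_) q)) p   ≡⟨ ℚ∑.∑-cong (λ t → ℚ∑.∑-map _ (t *ₜ_) q) p ⟩
  ∑ (λ t → ∑ (λ u → termCoeff (t *ₜ u) m) q) p            ∎
  where open ≡-Reasoning

∑-termCoeff-*ₜ : ∀ c (m₁ : Mon n) q m →
  ∑ (λ u → termCoeff ((c , m₁) *ₜ u) m) q ≡ (if m₁ ∣ₘ m then c ℚ.* coeff q (m /ₘ m₁) else 0ℚ)
∑-termCoeff-*ₜ c m₁ q m with m₁ ∣ₘ m in m₁∣ₘm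
... | true = begin
  ∑ (λ (d , u) → if monEq (m₁ *ₘ u) m then c ℚ.* d else 0ℚ) q       ≡⟨ ℚ∑.∑-cong shift q ⟩
  ∑ (λ t → c ℚ.* termCoeff t (m /ₘ m₁)) q                           ≡⟨ ∑-*ˡ c _ q ⟩
  c ℚ.* ∑ (λ t → termCoeff t (m /ₘ m₁)) q                           ≡⟨ cong (c ℚ.*_) (coeff-∑ q _) ⟨
  c ℚ.* coeff q (m /ₘ m₁)                                           ∎
  where
  open ≡-Reasoning
  shift : ∀ ((d , u) : ℚ × Mon _) →
          (if monEq (m₁ *ₘ u) m then c ℚ.* d else 0ℚ) ≡ c ℚ.* termCoeff (d , u) (m /ₘ m₁)
  shift (d , u) = trans (𝔹.if-cong (monEq-*ₘ {m₁ = m₁} {m} m₁∣ₘm u)) (if-*ˡ _ c d)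
... | false = ℚ∑.∑-identity (λ (d , u) → 𝔹.if-cong (monEq-*ₘ-∤ {m₁ = m₁} {m} m₁∣ₘm u)) q

coeff-*P : ∀ (p q : Poly n) m →
  coeff (p *P q) m ≡ ∑ (λ (c , m₁) → if m₁ ∣ₘ m then c ℚ.* coeff q (m /ₘ m₁) else 0ℚ) p
coeff-*P p q m = trans (coeff-*P-double p q m) (ℚ∑.∑-cong (λ (c , m₁) → ∑-termCoeff-*ₜ c m₁ q m) p)

coeff-homPart : ∀ d (p : Poly n) m → coeff (homPart d p) m ≡ (if totalDeg m ℕ.≡ᵇ d then coeff p m else 0ℚ)
coeff-homPart d p m = begin
  coeff (homPart d p) m
    ≡⟨ coeff-∑ (homPart d p) m ⟩
  ∑ (λ t → termCoeff t m) (homPart d p)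
    ≡⟨ ℚ∑.∑-filterᵇ _ _ p ⟩
  ∑ (λ (c , m′) → if totalDeg m′ ℕ.≡ᵇ d then termCoeff (c , m′) m else 0ℚ) p
    ≡⟨ ℚ∑.∑-cong degree p ⟩
  ∑ (λ t → if totalDeg m ℕ.≡ᵇ d then termCoeff t m else 0ℚ) p
    ≡⟨ ℚ∑.∑-if _ _ p ⟩
  (if totalDeg m ℕ.≡ᵇ d then ∑ (λ t → termCoeff t m) p else 0ℚ)
    ≡⟨ 𝔹.if-cong-then (totalDeg m ℕ.≡ᵇ d) (coeff-∑ p m) ⟨
  (if totalDeg m ℕ.≡ᵇ d then coeff p m else 0ℚ)
    ∎
  where
  open ≡-Reasoning
  degree : ∀ ((c , m′) : ℚ × Mon _) → (if totalDeg m′ ℕ.≡ᵇ d then termCoeff (c , m′) m else 0ℚ)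
                                     ≡ (if totalDeg m ℕ.≡ᵇ d then termCoeff (c , m′) m else 0ℚ)
  degree (c , m′) with monEq m′ m in m′≡m
  ... | true  = 𝔹.if-cong (cong (ℕ._≡ᵇ d) (monEq⇒totalDeg≡ {m = m′} {m} m′≡m))
  ... | false = trans (𝔹.if-eta (totalDeg m′ ℕ.≡ᵇ d)) (sym (𝔹.if-eta (totalDeg m ℕ.≡ᵇ d)))

coeff-homPart-above : ∀ d (p : Poly n) m → d < totalDeg m → coeff (homPart d p) m ≡ 0ℚ
coeff-homPart-above d p m d<deg = trans (coeff-homPart d p m)
  (𝔹.if-cong (dec-false (totalDeg m ℕ.≟ d) (ℕₚ.>⇒≢ d<deg)))

-- A record around _≈P_, so that the polynomials it relates can be inferred.
infix 4 _≋_
record _≋_ {n} (p q : Poly n) : Set where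
  constructor mk≋
  field coeff-≡ : p ≈P q
open _≋_ public

≋-isEquivalence : IsEquivalence (_≋_ {n})
≋-isEquivalence = record
  { refl  = mk≋ λ m → refl
  ; sym   = λ (mk≋ p≈q) → mk≋ λ m → sym (p≈q m)
  ; trans = λ (mk≋ p≈q) (mk≋ q≈r) → mk≋ λ m → trans (p≈q m) (q≈r m)
  }

≋-setoid : ℕ → Setoid _ _
≋-setoid n = record { isEquivalence = ≋-isEquivalence {n} }

module ≋ {n : ℕ} where
  open IsEquivalence (≋-isEquivalence {n}) public
  open SetoidReasoning (≋-setoid n) public

≡⇒≋ : {p q : Poly n} → p ≡ q → p ≋ q
≡⇒≋ refl = ≋.refl

+P-cong : {p p′ q q′ : Poly n} → p ≋ p′ → q ≋ q′ → p +P q ≋ p′ +P q′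
+P-cong {p = p} {p′} {q} {q′} (mk≋ p≈p′) (mk≋ q≈q′) = mk≋ λ m → begin
  coeff (p +P q) m          ≡⟨ coeff-+P p q m ⟩
  coeff p m ℚ.+ coeff q m   ≡⟨ cong₂ ℚ._+_ (p≈p′ m) (q≈q′ m) ⟩
  coeff p′ m ℚ.+ coeff q′ m ≡⟨ coeff-+P p′ q′ m ⟨
  coeff (p′ +P q′) m        ∎
  where open ≡-Reasoning

+P-identityʳ : {p q : Poly n} → q ≋ zeroP → p +P q ≋ p
+P-identityʳ {p = p} {q} (mk≋ q≈0) = mk≋ λ m →
  trans (coeff-+P p q m) (trans (cong (coeff p m ℚ.+_) (q≈0 m)) (ℚₚ.+-identityʳ _))

scaleP-cong : ∀ c {p q : Poly n} → p ≋ q → scaleP c p ≋ scaleP c q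
scaleP-cong c {p} {q} (mk≋ p≈q) = mk≋ λ m →
  trans (coeff-scaleP c p m) (trans (cong (c ℚ.*_) (p≈q m)) (sym (coeff-scaleP c q m)))

sumP-cong : {F G : X → Poly n} → (∀ x → F x ≋ G x) → ∀ xs → sumP (map F xs) ≋ sumP (map G xs)
sumP-cong {F = F} {G} F≋G xs = mk≋ λ m →
  trans (coeff-sumP F xs m) (trans (ℚ∑.∑-cong (λ x → coeff-≡ (F≋G x) m) xs) (sym (coeff-sumP G xs m)))

sumP-zero : {F : X → Poly n} → (∀ x → F x ≋ zeroP) → ∀ xs → sumP (map F xs) ≋ zeroP
sumP-zero {F = F} F≋0 xs = mk≋ λ m → trans (coeff-sumP F xs m) (ℚ∑.∑-identity (λ x → coeff-≡ (F≋0 x) m) xs)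

-- Poly n is a list of terms, so compatibility with _*P_ rests on the closed form coeff-*P.
*P-congʳ : ∀ (p : Poly n) {q q′ : Poly n} → q ≋ q′ → p *P q ≋ p *P q′
*P-congʳ p {q} {q′} (mk≋ q≈q′) = mk≋ λ m →
  trans (coeff-*P p q m) (trans (ℚ∑.∑-cong (same-terms m) p) (sym (coeff-*P p q′ m)))
  where
  same-terms : ∀ m ((c , m₁) : ℚ × Mon _) → (if m₁ ∣ₘ m then c ℚ.* coeff q (m /ₘ m₁) else 0ℚ)
                                            ≡ (if m₁ ∣ₘ m then c ℚ.* coeff q′ (m /ₘ m₁) else 0ℚ)
  same-terms m (c , m₁) = cong (λ x → if m₁ ∣ₘ m then c ℚ.* x else 0ℚ) (q≈q′ (m /ₘ m₁))

*P-comm : ∀ (p q : Poly n) → p *P q ≋ q *P p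
*P-comm p q = mk≋ λ m → begin
  coeff (p *P q) m                               ≡⟨ coeff-*P-double p q m ⟩
  ∑ (λ t → ∑ (λ u → termCoeff (t *ₜ u) m) q) p   ≡⟨ ℚ∑.∑-comm _ p q ⟩
  ∑ (λ u → ∑ (λ t → termCoeff (t *ₜ u) m) p) q   ≡⟨ ℚ∑.∑-cong (λ u → ℚ∑.∑-cong (*ₜ-comm m u) p) q ⟩
  ∑ (λ u → ∑ (λ t → termCoeff (u *ₜ t) m) p) q   ≡⟨ coeff-*P-double q p m ⟨
  coeff (q *P p) m                               ∎
  where
  open ≡-Reasoning
  *ₜ-comm : ∀ m u t → termCoeff (t *ₜ u) m ≡ termCoeff (u *ₜ t) m
  *ₜ-comm m (d , m₂) (c , m₁) = termCoeff-cong (ℚₚ.*-comm c d) (λ i j → ℕₚ.+-comm (m₁ i j) (m₂ i j)) m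

*P-cong : {p p′ q q′ : Poly n} → p ≋ p′ → q ≋ q′ → p *P q ≋ p′ *P q′
*P-cong {p = p} {p′} {q} {q′} p≋p′ q≋q′ = begin
  p *P q   ≈⟨ *P-congʳ p q≋q′ ⟩
  p *P q′  ≈⟨ *P-comm p q′ ⟩
  q′ *P p  ≈⟨ *P-congʳ q′ p≋p′ ⟩
  q′ *P p′ ≈⟨ *P-comm q′ p′ ⟩
  p′ *P q′ ∎
  where open ≋

*P-zeroˡ : {p : Poly n} (q : Poly n) → p ≋ zeroP → p *P q ≋ zeroP
*P-zeroˡ q p≋0 = *P-cong p≋0 (≋.refl {x = q})

powP-cong : {p q : Poly n} → p ≋ q → ∀ k → powP p k ≋ powP q k
powP-cong p≋q zero    = ≋.refl
powP-cong p≋q (suc k) = *P-cong p≋q (powP-cong p≋q k)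

homPart-cong : ∀ d {p q : Poly n} → p ≋ q → homPart d p ≋ homPart d q
homPart-cong d {p} {q} (mk≋ p≈q) = mk≋ λ m → trans (coeff-homPart d p m)
  (trans (𝔹.if-cong-then (totalDeg m ℕ.≡ᵇ d) (p≈q m)) (sym (coeff-homPart d q m)))

coeff-sumP-allFin : ∀ {k} (F : Fin k → Poly n) m →
  coeff (sumP (map F (allFin k))) m ≡ ℚΣ.sum (λ i → coeff (F i) m)
coeff-sumP-allFin {k = k} F m = trans (coeff-sumP F (allFin k) m) (ℚ∑.∑-allFin (λ i → coeff (F i) m))

sumP-allFin-permute : ∀ {k} (F : Fin k → Poly n) (π : Permutation′ k) →
  sumP (map F (allFin k)) ≋ sumP (map (λ i → F (π ⟨$⟩ʳ i)) (allFin k))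
sumP-allFin-permute F π = mk≋ λ m → begin
  coeff (sumP (map F (allFin _))) m                        ≡⟨ coeff-sumP-allFin F m ⟩
  ℚΣ.sum (λ i → coeff (F i) m)                        ≡⟨ ℚΣ.sum-permute (λ i → coeff (F i) m) π ⟩
  ℚΣ.sum (λ i → coeff (F (π ⟨$⟩ʳ i)) m)              ≡⟨ coeff-sumP-allFin (λ i → F (π ⟨$⟩ʳ i)) m ⟨
  coeff (sumP (map (λ i → F (π ⟨$⟩ʳ i)) (allFin _))) m    ∎
  where open ≡-Reasoning

sumP-allFin-init-last : ∀ {k} (F : Fin (suc k) → Poly n) →
  sumP (map F (allFin (suc k))) ≋ sumP (map (F ∘ inject₁) (allFin k)) +P F (fromℕ k)
sumP-allFin-init-last {k = k} F = mk≋ λ m → begin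
  coeff (sumP (map F (allFin (suc k)))) m
    ≡⟨ coeff-sumP-allFin F m ⟩
  ℚΣ.sum (λ i → coeff (F i) m)
    ≡⟨ ℚΣ.sum-init-last (λ i → coeff (F i) m) ⟩
  ℚΣ.sum (λ i → coeff (F (inject₁ i)) m) ℚ.+ coeff (F (fromℕ k)) m
    ≡⟨ cong (ℚ._+ coeff (F (fromℕ k)) m) (coeff-sumP-allFin (F ∘ inject₁) m) ⟨
  coeff (sumP (map (F ∘ inject₁) (allFin k))) m ℚ.+ coeff (F (fromℕ k)) m
    ≡⟨ coeff-+P (sumP (map (F ∘ inject₁) (allFin k))) (F (fromℕ k)) m ⟨
  coeff (sumP (map (F ∘ inject₁) (allFin k)) +P F (fromℕ k)) m
    ∎
  where open ≡-Reasoning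

infix 4 _==_
_==_ : Fin n → Fin n → Bool
i == j = toℕ i ℕ.≡ᵇ toℕ j

==-refl : ∀ (i : Fin n) → (i == i) ≡ true
==-refl i = dec-true (toℕ i ℕ.≟ toℕ i) refl

==-≢ : ∀ {i j : Fin n} → i ≢ j → (i == j) ≡ false
==-≢ {i = i} {j} i≢j = dec-false (toℕ i ℕ.≟ toℕ j) (i≢j ∘ toℕ-injective)

==-injective : (f : Fin a → Fin b) → (∀ {x y} → f x ≡ f y → x ≡ y) → ∀ i j → (f i == f j) ≡ (i == j)
==-injective f f-injective i j with i Fin.≟ j
... | yes refl = trans (==-refl (f i)) (sym (==-refl i))
... | no  i≢j  = trans (==-≢ (i≢j ∘ f-injective)) (sym (==-≢ i≢j))

⟨$⟩ʳ-injective : (π : Permutation′ n) → ∀ {x y} → π ⟨$⟩ʳ x ≡ π ⟨$⟩ʳ y → x ≡ y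
⟨$⟩ʳ-injective π {x} {y} e = trans (sym (inverseˡ π)) (trans (cong (π ⟨$⟩ˡ_) e) (inverseˡ π))

≡ᵇ-false : ∀ {x y} → x ≢ y → (x ℕ.≡ᵇ y) ≡ false
≡ᵇ-false {x} {y} = dec-false (x ℕ.≟ y)

<ᵇ-true : ∀ {x y} → x < y → (x ℕ.<ᵇ y) ≡ true
<ᵇ-true {x} {y} = dec-true (x ℕ.<? y)

<ᵇ-false : ∀ {x y} → ¬ x < y → (x ℕ.<ᵇ y) ≡ false
<ᵇ-false {x} {y} = dec-false (x ℕ.<? y)

upperSum : (Fin n → Fin n → ℕ) → ℕ
upperSum t = ℕΣ.sum (λ i → ℕΣ.sum (λ j → if toℕ i ℕ.<ᵇ toℕ j then t i j else 0))

offDiagSum : (Fin n → Fin n → ℕ) → ℕ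
offDiagSum t = ℕΣ.sum (λ i → ℕΣ.sum (λ j → if i == j then 0 else t i j))

totalDeg≡upperSum : (m : Mon n) → totalDeg m ≡ upperSum m
totalDeg≡upperSum {n} m = begin
  totalDeg m
    ≡⟨ ℕ∑.∑-concatMap deg _ (allFin n) ⟩
  ℕ∑.∑ (λ i → ℕ∑.∑ deg (concatMap (λ j → if toℕ i ℕ.<ᵇ toℕ j then [ (i , j) ] else []) (allFin n))) (allFin n)
    ≡⟨ ℕ∑.∑-cong (λ i → trans (ℕ∑.∑-concatMap deg _ (allFin n)) (ℕ∑.∑-cong (singleton i) (allFin n))) (allFin n) ⟩
  ℕ∑.∑ (λ i → ℕ∑.∑ (upper i) (allFin n)) (allFin n)
    ≡⟨ trans (ℕ∑.∑-cong (λ i → ℕ∑.∑-allFin (upper i)) (allFin n)) (ℕ∑.∑-allFin (λ i → ℕΣ.sum (upper i))) ⟩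
  upperSum m ∎
  where
  open ≡-Reasoning
  deg : Fin n × Fin n → ℕ
  deg (i , j) = m i j
  upper : Fin n → Fin n → ℕ
  upper i j = if toℕ i ℕ.<ᵇ toℕ j then m i j else 0
  singleton : ∀ i j → ℕ∑.∑ deg (if toℕ i ℕ.<ᵇ toℕ j then [ (i , j) ] else []) ≡ upper i j
  singleton i j with toℕ i ℕ.<ᵇ toℕ j
  ... | true  = ℕₚ.+-identityʳ (m i j)
  ... | false = refl

off-diagonal-split : ∀ x y {s t} → s ≡ t →
  (if x ℕ.≡ᵇ y then 0 else s) ≡ (if x ℕ.<ᵇ y then s else 0) ℕ.+ (if y ℕ.<ᵇ x then t else 0)
off-diagonal-split x y s≡t with ℕₚ.<-cmp x y
... | tri< x<y x≢y _   rewrite ≡ᵇ-false x≢y | <ᵇ-true x<y | <ᵇ-false (ℕₚ.<⇒≯ x<y) = sym (ℕₚ.+-identityʳ _)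
... | tri> _   x≢y y<x rewrite ≡ᵇ-false x≢y | <ᵇ-true y<x | <ᵇ-false (ℕₚ.<⇒≯ y<x) = s≡t
... | tri≈ _   refl _  rewrite dec-true (x ℕ.≟ x) refl | <ᵇ-false (ℕₚ.<-irrefl {x} refl) = refl

offDiagSum-symmetric : (t : Fin n → Fin n → ℕ) → (∀ i j → t i j ≡ t j i) → offDiagSum t ≡ 2 ℕ.* upperSum t
offDiagSum-symmetric t t-sym = begin
  offDiagSum t
    ≡⟨ ℕΣ.sum-cong-≗ (λ i → ℕΣ.sum-cong-≗ (λ j → off-diagonal-split (toℕ i) (toℕ j) (t-sym i j))) ⟩
  ℕΣ.sum (λ i → ℕΣ.sum (λ j → upper i j ℕ.+ lower i j))
    ≡⟨ ℕΣ.sum-cong-≗ (λ i → ℕΣ.∑-distrib-+ (upper i) (lower i)) ⟩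
  ℕΣ.sum (λ i → ℕΣ.sum (upper i) ℕ.+ ℕΣ.sum (lower i))
    ≡⟨ ℕΣ.∑-distrib-+ (λ i → ℕΣ.sum (upper i)) (λ i → ℕΣ.sum (lower i)) ⟩
  upperSum t ℕ.+ ℕΣ.sum (λ i → ℕΣ.sum (lower i))
    ≡⟨ cong (upperSum t ℕ.+_) (trans (ℕΣ.∑-comm lower) (sym (ℕₚ.+-identityʳ _))) ⟩
  2 ℕ.* upperSum t ∎
  where
  open ≡-Reasoning
  upper lower : Fin _ → Fin _ → ℕ
  upper i j = if toℕ i ℕ.<ᵇ toℕ j then t i j else 0
  lower i j = if toℕ j ℕ.<ᵇ toℕ i then t j i else 0

offDiagSum-permute : (π : Permutation′ n) (t : Fin n → Fin n → ℕ) →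
  offDiagSum (λ i j → t (π ⟨$⟩ʳ i) (π ⟨$⟩ʳ j)) ≡ offDiagSum t
offDiagSum-permute π t = begin
  offDiagSum (λ i j → t (π ⟨$⟩ʳ i) (π ⟨$⟩ʳ j))
    ≡⟨ ℕΣ.sum-cong-≗ (λ i → ℕΣ.sum-cong-≗ (λ j → cong (λ b → if b then 0 else t (π ⟨$⟩ʳ i) (π ⟨$⟩ʳ j))
                                                     (sym (==-injective (π ⟨$⟩ʳ_) (⟨$⟩ʳ-injective π) i j)))) ⟩
  ℕΣ.sum (λ i → ℕΣ.sum (λ j → off (π ⟨$⟩ʳ i) (π ⟨$⟩ʳ j)))
    ≡⟨ ℕΣ.sum-cong-≗ (λ i → sym (ℕΣ.sum-permute (off (π ⟨$⟩ʳ i)) π)) ⟩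
  ℕΣ.sum (λ i → ℕΣ.sum (off (π ⟨$⟩ʳ i)))
    ≡⟨ sym (ℕΣ.sum-permute (λ i → ℕΣ.sum (off i)) π) ⟩
  offDiagSum t ∎
  where
  open ≡-Reasoning
  off : Fin _ → Fin _ → ℕ
  off i j = if i == j then 0 else t i j

symExp-sym : (m : Mon n) → ∀ i j → symExp m i j ≡ symExp m j i
symExp-sym m i j with ℕₚ.<-cmp (toℕ i) (toℕ j)
... | tri< i<j _ _   rewrite <ᵇ-true i<j | <ᵇ-false (ℕₚ.<⇒≯ i<j) = refl
... | tri> _   _ j<i rewrite <ᵇ-true j<i | <ᵇ-false (ℕₚ.<⇒≯ j<i) = refl
... | tri≈ _ i≡j _   rewrite toℕ-injective i≡j = refl

upperSum-symExp : (m : Mon n) → upperSum (symExp m) ≡ upperSum m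
upperSum-symExp m = ℕΣ.sum-cong-≗ λ i → ℕΣ.sum-cong-≗ λ j → upper i j
  where
  upper : ∀ i j → (if toℕ i ℕ.<ᵇ toℕ j then symExp m i j else 0) ≡ (if toℕ i ℕ.<ᵇ toℕ j then m i j else 0)
  upper i j with toℕ i ℕ.<ᵇ toℕ j
  ... | true  = refl
  ... | false = refl

-- Over all pairs i ≠ j a symmetric exponent table sums to twice its total degree,
-- and this sum does not see a relabelling of the indices.
totalDeg-permute : (π : Permutation′ n) (m : Mon n) → totalDeg (λ i j → symExp m (π ⟨$⟩ʳ i) (π ⟨$⟩ʳ j)) ≡ totalDeg m
totalDeg-permute π m = begin
  totalDeg πm       ≡⟨ totalDeg≡upperSum πm ⟩
  upperSum πm       ≡⟨ ℕₚ.*-cancelˡ-≡ _ _ 2 doubled ⟩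
  upperSum (symExp m) ≡⟨ upperSum-symExp m ⟩
  upperSum m        ≡⟨ totalDeg≡upperSum m ⟨
  totalDeg m        ∎
  where
  open ≡-Reasoning
  πm : Mon _
  πm i j = symExp m (π ⟨$⟩ʳ i) (π ⟨$⟩ʳ j)
  doubled : 2 ℕ.* upperSum πm ≡ 2 ℕ.* upperSum (symExp m)
  doubled = begin
    2 ℕ.* upperSum πm          ≡⟨ offDiagSum-symmetric πm (λ i j → symExp-sym m _ _) ⟨
    offDiagSum πm              ≡⟨ offDiagSum-permute π (symExp m) ⟩
    offDiagSum (symExp m)      ≡⟨ offDiagSum-symmetric (symExp m) (symExp-sym m) ⟩
    2 ℕ.* upperSum (symExp m)  ∎

upperSum-restrict : (m : Mon (suc n)) → (∀ i → m (inject₁ i) (fromℕ n) ≡ 0) →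
  upperSum m ≡ upperSum (λ i j → m (inject₁ i) (inject₁ j))
upperSum-restrict {n} m last-column-zero = begin
  upperSum m                                                     ≡⟨ ℕΣ.sum-init-last (λ i → ℕΣ.sum (upper i)) ⟩
  ℕΣ.sum (λ i → ℕΣ.sum (upper (inject₁ i))) ℕ.+ ℕΣ.sum (upper (fromℕ n))
    ≡⟨ cong₂ ℕ._+_ (ℕΣ.sum-cong-≗ inner-row) last-row ⟩
  upperSum (λ i j → m (inject₁ i) (inject₁ j)) ℕ.+ 0            ≡⟨ ℕₚ.+-identityʳ _ ⟩
  upperSum (λ i j → m (inject₁ i) (inject₁ j))                   ∎
  where
  open ≡-Reasoning
  upper : Fin (suc n) → Fin (suc n) → ℕ
  upper i j = if toℕ i ℕ.<ᵇ toℕ j then m i j else 0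
  last-row : ℕΣ.sum (upper (fromℕ n)) ≡ 0
  last-row = trans (ℕΣ.sum-cong-≗ λ j → cong (λ b → if b then m (fromℕ n) j else 0) (<ᵇ-false (last≮ j)))
                   (ℕΣ.sum-replicate-zero (suc n))
    where
    last≮ : ∀ j → ¬ toℕ (fromℕ n) < toℕ j
    last≮ j lt = ℕₚ.<-irrefl refl (ℕₚ.<-≤-trans (toℕ<n j) (subst (ℕ._< toℕ j) (toℕ-fromℕ n) lt))
  inner-row : ∀ i → ℕΣ.sum (upper (inject₁ i))
                  ≡ ℕΣ.sum (λ j → if toℕ i ℕ.<ᵇ toℕ j then m (inject₁ i) (inject₁ j) else 0)
  inner-row i = begin
    ℕΣ.sum (upper (inject₁ i))                                             ≡⟨ ℕΣ.sum-init-last (upper (inject₁ i)) ⟩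
    ℕΣ.sum (λ j → upper (inject₁ i) (inject₁ j)) ℕ.+ upper (inject₁ i) (fromℕ n)
      ≡⟨ cong₂ ℕ._+_ (ℕΣ.sum-cong-≗ λ j → cong₂ (λ x y → if x ℕ.<ᵇ y then m (inject₁ i) (inject₁ j) else 0)
                                                  (toℕ-inject₁ i) (toℕ-inject₁ j))
                     (trans (𝔹.if-cong-then (toℕ (inject₁ i) ℕ.<ᵇ toℕ (fromℕ n)) (last-column-zero i)) (𝔹.if-eta _)) ⟩
    ℕΣ.sum (λ j → if toℕ i ℕ.<ᵇ toℕ j then m (inject₁ i) (inject₁ j) else 0) ℕ.+ 0 ≡⟨ ℕₚ.+-identityʳ _ ⟩
    ℕΣ.sum (λ j → if toℕ i ℕ.<ᵇ toℕ j then m (inject₁ i) (inject₁ j) else 0)       ∎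

totalDeg-restrict : (m : Mon (suc n)) → (∀ i → m (inject₁ i) (fromℕ n) ≡ 0) →
  totalDeg (λ i j → m (inject₁ i) (inject₁ j)) ≡ totalDeg m
totalDeg-restrict m last-column-zero = begin
  totalDeg (λ i j → m (inject₁ i) (inject₁ j)) ≡⟨ totalDeg≡upperSum (λ i j → m (inject₁ i) (inject₁ j)) ⟩
  upperSum (λ i j → m (inject₁ i) (inject₁ j)) ≡⟨ upperSum-restrict m last-column-zero ⟨
  upperSum m                                   ≡⟨ totalDeg≡upperSum m ⟨
  totalDeg m                                   ∎
  where open ≡-Reasoning

term-cong : ∀ {c d} {m m′ : Mon n} → c ≡ d → m ≗ₘ m′ → [ (c , m) ] ≋ [ (d , m′) ]
term-cong {c = c} {d} {m} {m′} c≡d m≗m′ = mk≋ λ k →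
  trans (coeff-∑ [ (c , m) ] k) (trans (cong (ℚ._+ 0ℚ) (termCoeff-cong c≡d m≗m′ k)) (sym (coeff-∑ [ (d , m′) ] k)))

∷-cong : ∀ {c d} {m m′ : Mon n} {p q} → c ≡ d → m ≗ₘ m′ → p ≋ q → (c , m) ∷ p ≋ (d , m′) ∷ q
∷-cong c≡d m≗m′ p≋q = +P-cong (term-cong c≡d m≗m′) p≋q

-- Relabelling the variables and setting some of them to zero are maps of this form.
record MonomialMap (a b : ℕ) : Set where
  field
    keep            : Mon a → Bool
    rename          : Mon a → Mon b
    keep-*ₘ         : ∀ m m′ → keep (m *ₘ m′) ≡ keep m ∧ keep m′
    rename-*ₘ       : ∀ m m′ → rename (m *ₘ m′) ≗ₘ rename m *ₘ rename m′
    keep-one        : keep oneMon ≡ true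
    rename-one      : rename oneMon ≗ₘ oneMon
    rename-totalDeg : ∀ m → keep m ≡ true → totalDeg (rename m) ≡ totalDeg m

⟦_⟧ : MonomialMap a b → Poly a → Poly b
⟦ f ⟧ p = map (λ (c , m) → (c , rename m)) (filterᵇ (λ (_ , m) → keep m) p)
  where open MonomialMap f

module _ (f : MonomialMap a b) where
  open MonomialMap f

  ⟦⟧-+P : ∀ (p q : Poly a) → ⟦ f ⟧ (p +P q) ≡ ⟦ f ⟧ p +P ⟦ f ⟧ q
  ⟦⟧-+P []             q = refl
  ⟦⟧-+P ((c , m) ∷ p) q with keep m
  ... | true  = cong ((c , rename m) ∷_) (⟦⟧-+P p q)
  ... | false = ⟦⟧-+P p q

  ⟦⟧-sumP : ∀ (F : X → Poly a) xs → ⟦ f ⟧ (sumP (map F xs)) ≡ sumP (map (⟦ f ⟧ ∘ F) xs)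
  ⟦⟧-sumP F []       = refl
  ⟦⟧-sumP F (x ∷ xs) = trans (⟦⟧-+P (F x) _) (cong (⟦ f ⟧ (F x) +P_) (⟦⟧-sumP F xs))

  ⟦⟧-scaleP : ∀ c (p : Poly a) → ⟦ f ⟧ (scaleP c p) ≡ scaleP c (⟦ f ⟧ p)
  ⟦⟧-scaleP c []             = refl
  ⟦⟧-scaleP c ((d , m) ∷ p) with keep m
  ... | true  = cong ((c ℚ.* d , rename m) ∷_) (⟦⟧-scaleP c p)
  ... | false = ⟦⟧-scaleP c p

  ⟦⟧-scaleP-≋ : ∀ c (p : Poly a) {q} → ⟦ f ⟧ p ≋ q → ⟦ f ⟧ (scaleP c p) ≋ scaleP c q
  ⟦⟧-scaleP-≋ c p p↦q = ≋.trans (≡⇒≋ (⟦⟧-scaleP c p)) (scaleP-cong c p↦q)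

  ⟦⟧-homPart : ∀ d (p : Poly a) → ⟦ f ⟧ (homPart d p) ≡ homPart d (⟦ f ⟧ p)
  ⟦⟧-homPart d []             = refl
  ⟦⟧-homPart d ((c , m) ∷ p) with keep m in kept
  ... | true rewrite rename-totalDeg m kept with totalDeg m ℕ.≡ᵇ d
  ...   | true rewrite kept = cong ((c , rename m) ∷_) (⟦⟧-homPart d p)
  ...   | false = ⟦⟧-homPart d p
  ⟦⟧-homPart d ((c , m) ∷ p) | false with totalDeg m ℕ.≡ᵇ d
  ...   | true rewrite kept = ⟦⟧-homPart d p
  ...   | false = ⟦⟧-homPart d p

  ⟦⟧-kept : ∀ {c m m′} → keep m ≡ true → rename m ≗ₘ m′ → ⟦ f ⟧ [ (c , m) ] ≋ [ (c , m′) ]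
  ⟦⟧-kept kept renamed rewrite kept = term-cong refl renamed

  ⟦⟧-killed : ∀ {c m} → keep m ≡ false → ⟦ f ⟧ [ (c , m) ] ≡ zeroP
  ⟦⟧-killed killed rewrite killed = refl

  ⟦⟧-one : ⟦ f ⟧ (constP 1ℚ) ≋ constP 1ℚ
  ⟦⟧-one = ⟦⟧-kept keep-one rename-one

  ⟦⟧-*ₜ-kept : ∀ c m → keep m ≡ true → ∀ q → ⟦ f ⟧ (map ((c , m) *ₜ_) q) ≋ map ((c , rename m) *ₜ_) (⟦ f ⟧ q)
  ⟦⟧-*ₜ-kept c m kept []              = ≋.refl
  ⟦⟧-*ₜ-kept c m kept ((d , m′) ∷ q) rewrite keep-*ₘ m m′ | kept with keep m′
  ... | true  = ∷-cong refl (rename-*ₘ m m′) (⟦⟧-*ₜ-kept c m kept q)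
  ... | false = ⟦⟧-*ₜ-kept c m kept q

  ⟦⟧-*ₜ-killed : ∀ c m → keep m ≡ false → ∀ q → ⟦ f ⟧ (map ((c , m) *ₜ_) q) ≡ zeroP
  ⟦⟧-*ₜ-killed c m killed []              = refl
  ⟦⟧-*ₜ-killed c m killed ((d , m′) ∷ q) rewrite keep-*ₘ m m′ | killed = ⟦⟧-*ₜ-killed c m killed q

  ⟦⟧-*P : ∀ (p q : Poly a) → ⟦ f ⟧ (p *P q) ≋ ⟦ f ⟧ p *P ⟦ f ⟧ q
  ⟦⟧-*P []             q = ≋.refl
  ⟦⟧-*P ((c , m) ∷ p) q with keep m in kept
  ... | true  = begin
    ⟦ f ⟧ (map ((c , m) *ₜ_) q +P p *P q)                       ≡⟨ ⟦⟧-+P (map ((c , m) *ₜ_) q) (p *P q) ⟩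
    ⟦ f ⟧ (map ((c , m) *ₜ_) q) +P ⟦ f ⟧ (p *P q)               ≈⟨ +P-cong (⟦⟧-*ₜ-kept c m kept q) (⟦⟧-*P p q) ⟩
    map ((c , rename m) *ₜ_) (⟦ f ⟧ q) +P ⟦ f ⟧ p *P ⟦ f ⟧ q   ∎
    where open ≋
  ... | false = begin
    ⟦ f ⟧ (map ((c , m) *ₜ_) q +P p *P q)                       ≡⟨ ⟦⟧-+P (map ((c , m) *ₜ_) q) (p *P q) ⟩
    ⟦ f ⟧ (map ((c , m) *ₜ_) q) +P ⟦ f ⟧ (p *P q)               ≡⟨ cong (_+P _) (⟦⟧-*ₜ-killed c m kept q) ⟩
    ⟦ f ⟧ (p *P q)                                               ≈⟨ ⟦⟧-*P p q ⟩
    ⟦ f ⟧ p *P ⟦ f ⟧ q                                           ∎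
    where open ≋

  ⟦⟧-powP : ∀ (p : Poly a) k → ⟦ f ⟧ (powP p k) ≋ powP (⟦ f ⟧ p) k
  ⟦⟧-powP p zero    = ⟦⟧-one
  ⟦⟧-powP p (suc k) = ≋.trans (⟦⟧-*P p (powP p k)) (*P-congʳ (⟦ f ⟧ p) (⟦⟧-powP p k))

  ⟦⟧-*P-zeroˡ : ∀ (p q : Poly a) → ⟦ f ⟧ p ≋ zeroP → ⟦ f ⟧ (p *P q) ≋ zeroP
  ⟦⟧-*P-zeroˡ p q p↦0 = ≋.trans (⟦⟧-*P p q) (*P-zeroˡ (⟦ f ⟧ q) p↦0)

⟦⟧-if-one : (f : MonomialMap a b) → ∀ c → ⟦ f ⟧ (if c then constP 1ℚ else zeroP) ≋ (if c then constP 1ℚ else zeroP)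
⟦⟧-if-one f true  = ⟦⟧-one f
⟦⟧-if-one f false = ≋.refl

⟦⟧-idM : (f : MonomialMap a b) → ∀ i j i′ j′ → (i == j) ≡ (i′ == j′) → ⟦ f ⟧ (idM i j) ≋ idM i′ j′
⟦⟧-idM f i j i′ j′ i=j≡i′=j′ = ≋.trans (⟦⟧-if-one f (i == j)) (≡⇒≋ (𝔹.if-cong i=j≡i′=j′))

Relabels : MonomialMap n n → Permutation′ n → Mat n → Mat n → Set
Relabels f π M N = ∀ i j → ⟦ f ⟧ (M i j) ≋ N (π ⟨$⟩ʳ i) (π ⟨$⟩ʳ j)

module _ (f : MonomialMap n n) (π : Permutation′ n) where

  ·M-relabels : ∀ {M M′ N N′} → Relabels f π M N → Relabels f π M′ N′ → Relabels f π (M ·M M′) (N ·M N′)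
  ·M-relabels {M} {M′} {N} {N′} M↦N M′↦N′ i j = begin
    ⟦ f ⟧ (sumP (map (λ k → M i k *P M′ k j) (allFin n)))
      ≡⟨ ⟦⟧-sumP f (λ k → M i k *P M′ k j) (allFin n) ⟩
    sumP (map (λ k → ⟦ f ⟧ (M i k *P M′ k j)) (allFin n))
      ≈⟨ sumP-cong (λ k → ≋.trans (⟦⟧-*P f (M i k) (M′ k j)) (*P-cong (M↦N i k) (M′↦N′ k j))) (allFin n) ⟩
    sumP (map (λ k → N (π ⟨$⟩ʳ i) (π ⟨$⟩ʳ k) *P N′ (π ⟨$⟩ʳ k) (π ⟨$⟩ʳ j)) (allFin n))
      ≈⟨ sumP-allFin-permute (λ k → N (π ⟨$⟩ʳ i) k *P N′ k (π ⟨$⟩ʳ j)) π ⟨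
    sumP (map (λ k → N (π ⟨$⟩ʳ i) k *P N′ k (π ⟨$⟩ʳ j)) (allFin n)) ∎
    where open ≋

  idM-relabels : Relabels f π idM idM
  idM-relabels i j = ⟦⟧-idM f i j (π ⟨$⟩ʳ i) (π ⟨$⟩ʳ j) (sym (==-injective (π ⟨$⟩ʳ_) (⟨$⟩ʳ-injective π) i j))

  powM-relabels : ∀ {M N} → Relabels f π M N → ∀ k → Relabels f π (powM M k) (powM N k)
  powM-relabels         M↦N zero    = idM-relabels
  powM-relabels {M} {N} M↦N (suc k) = ·M-relabels {M} {powM M k} {N} {powM N k} M↦N (powM-relabels M↦N k)

  trace-relabels : ∀ {M N} → Relabels f π M N → ⟦ f ⟧ (trace M) ≋ trace N
  trace-relabels {M} {N} M↦N = begin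
    ⟦ f ⟧ (sumP (map (λ i → M i i) (allFin n)))                   ≡⟨ ⟦⟧-sumP f (λ i → M i i) (allFin n) ⟩
    sumP (map (λ i → ⟦ f ⟧ (M i i)) (allFin n))                   ≈⟨ sumP-cong (λ i → M↦N i i) (allFin n) ⟩
    sumP (map (λ i → N (π ⟨$⟩ʳ i) (π ⟨$⟩ʳ i)) (allFin n))         ≈⟨ sumP-allFin-permute (λ i → N i i) π ⟨
    sumP (map (λ i → N i i) (allFin n))                           ∎
    where open ≋

Restricts : MonomialMap (suc n) n → Mat (suc n) → Mat n → Set
Restricts f M N = ∀ i j → ⟦ f ⟧ (M (inject₁ i) (inject₁ j)) ≋ N i j

module _ (f : MonomialMap (suc n) n) where

  ⟦⟧-sumP-allFin-last-zero : (F : Fin (suc n) → Poly (suc n)) → ⟦ f ⟧ (F (fromℕ n)) ≋ zeroP →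
    ⟦ f ⟧ (sumP (map F (allFin (suc n)))) ≋ sumP (map (λ i → ⟦ f ⟧ (F (inject₁ i))) (allFin n))
  ⟦⟧-sumP-allFin-last-zero F last↦0 = begin
    ⟦ f ⟧ (sumP (map F (allFin (suc n))))                                     ≡⟨ ⟦⟧-sumP f F (allFin (suc n)) ⟩
    sumP (map (⟦ f ⟧ ∘ F) (allFin (suc n)))                                   ≈⟨ sumP-allFin-init-last (⟦ f ⟧ ∘ F) ⟩
    sumP (map (λ i → ⟦ f ⟧ (F (inject₁ i))) (allFin n)) +P ⟦ f ⟧ (F (fromℕ n)) ≈⟨ +P-identityʳ last↦0 ⟩
    sumP (map (λ i → ⟦ f ⟧ (F (inject₁ i))) (allFin n))                       ∎
    where open ≋

  ·M-restricts : ∀ {M M′ N N′} → Restricts f M N → (∀ i → ⟦ f ⟧ (M (inject₁ i) (fromℕ n)) ≋ zeroP) →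
    Restricts f M′ N′ → Restricts f (M ·M M′) (N ·M N′)
  ·M-restricts {M} {M′} {N} {N′} M↦N last-column↦0 M′↦N′ i j = begin
    ⟦ f ⟧ (sumP (map (λ k → M (inject₁ i) k *P M′ k (inject₁ j)) (allFin (suc n))))
      ≈⟨ ⟦⟧-sumP-allFin-last-zero (λ k → M (inject₁ i) k *P M′ k (inject₁ j))
           (⟦⟧-*P-zeroˡ f (M (inject₁ i) (fromℕ n)) (M′ (fromℕ n) (inject₁ j)) (last-column↦0 i)) ⟩
    sumP (map (λ k → ⟦ f ⟧ (M (inject₁ i) (inject₁ k) *P M′ (inject₁ k) (inject₁ j))) (allFin n))
      ≈⟨ sumP-cong (λ k → ≋.trans (⟦⟧-*P f (M (inject₁ i) (inject₁ k)) (M′ (inject₁ k) (inject₁ j)))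
                                  (*P-cong (M↦N i k) (M′↦N′ k j))) (allFin n) ⟩
    sumP (map (λ k → N i k *P N′ k j) (allFin n))
      ∎
    where open ≋

  powM-restricts : ∀ {M N} → Restricts f M N → (∀ i → ⟦ f ⟧ (M (inject₁ i) (fromℕ n)) ≋ zeroP) →
    ∀ k → Restricts f (powM M k) (powM N k)
  powM-restricts         M↦N last-column↦0 zero    = λ i j →
    ⟦⟧-idM f (inject₁ i) (inject₁ j) i j (==-injective inject₁ inject₁-injective i j)
  powM-restricts {M} {N} M↦N last-column↦0 (suc k) =
    ·M-restricts {M} {powM M k} {N} {powM N k} M↦N last-column↦0 (powM-restricts M↦N last-column↦0 k)

  ·M-last-row↦0 : ∀ {M} M′ → (∀ j → ⟦ f ⟧ (M (fromℕ n) j) ≋ zeroP) →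
    ∀ j → ⟦ f ⟧ ((M ·M M′) (fromℕ n) j) ≋ zeroP
  ·M-last-row↦0 {M} M′ last-row↦0 j = begin
    ⟦ f ⟧ (sumP (map (λ k → M (fromℕ n) k *P M′ k j) (allFin (suc n))))
      ≡⟨ ⟦⟧-sumP f (λ k → M (fromℕ n) k *P M′ k j) (allFin (suc n)) ⟩
    sumP (map (λ k → ⟦ f ⟧ (M (fromℕ n) k *P M′ k j)) (allFin (suc n)))
      ≈⟨ sumP-zero (λ k → ⟦⟧-*P-zeroˡ f (M (fromℕ n) k) (M′ k j) (last-row↦0 k)) (allFin (suc n)) ⟩
    zeroP
      ∎
    where open ≋

  trace-restricts : ∀ {M N} → Restricts f M N → ⟦ f ⟧ (M (fromℕ n) (fromℕ n)) ≋ zeroP →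
    ⟦ f ⟧ (trace M) ≋ trace N
  trace-restricts {M} {N} M↦N corner↦0 = begin
    ⟦ f ⟧ (sumP (map (λ i → M i i) (allFin (suc n))))                  ≈⟨ ⟦⟧-sumP-allFin-last-zero (λ i → M i i) corner↦0 ⟩
    sumP (map (λ i → ⟦ f ⟧ (M (inject₁ i) (inject₁ i))) (allFin n))    ≈⟨ sumP-cong (λ i → M↦N i i) (allFin n) ⟩
    sumP (map (λ i → N i i) (allFin n))                                ∎
    where open ≋

-- var i j is [ (1ℚ , varMon i j) ]
varMon : Fin n → Fin n → Mon n
varMon i j a b = if ((a == i) ∧ (b == j)) ∨ ((a == j) ∧ (b == i)) then 1 else 0

varMon-sym : ∀ (i j a b : Fin n) → varMon i j a b ≡ varMon i j b a
varMon-sym i j a b = cong (λ c → if c then 1 else 0)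
  (trans (𝔹.∨-comm ((a == i) ∧ (b == j)) _) (cong₂ _∨_ (𝔹.∧-comm (a == j) (b == i)) (𝔹.∧-comm (a == i) (b == j))))

-- A n i j unfolds to  if i == j then diagA i else offA i j
diagA : Fin n → Poly n
diagA {n} i = sumP (map (λ k → if k == i then zeroP else var i k) (allFin n))

offA : Fin n → Fin n → Poly n
offA i j = scaleP (ℚ.- 1ℚ) (var i j)

-- Permuting the variables

symExp-*ₘ : ∀ (m m′ : Mon n) i j → symExp (m *ₘ m′) i j ≡ symExp m i j ℕ.+ symExp m′ i j
symExp-*ₘ m m′ i j with toℕ i ℕ.<ᵇ toℕ j
... | true  = refl
... | false = refl

symExp-symmetric : ∀ (m : Mon n) → (∀ i j → m i j ≡ m j i) → ∀ i j → symExp m i j ≡ m i j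
symExp-symmetric m m-sym i j with toℕ i ℕ.<ᵇ toℕ j
... | true  = refl
... | false = m-sym j i

permute : Permutation′ n → MonomialMap n n
permute σ = record
  { keep            = λ _ → true
  ; rename          = λ m a b → symExp m (σ ⟨$⟩ʳ a) (σ ⟨$⟩ʳ b)
  ; keep-*ₘ         = λ _ _ → refl
  ; rename-*ₘ       = λ m m′ a b → symExp-*ₘ m m′ (σ ⟨$⟩ʳ a) (σ ⟨$⟩ʳ b)
  ; keep-one        = refl
  ; rename-one      = λ a b → 𝔹.if-eta (toℕ (σ ⟨$⟩ʳ a) ℕ.<ᵇ toℕ (σ ⟨$⟩ʳ b))
  ; rename-totalDeg = λ m _ → totalDeg-permute σ m
  }

act≡⟦permute⟧ : (σ : Permutation′ n) (p : Poly n) → act σ p ≡ ⟦ permute σ ⟧ p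
act≡⟦permute⟧ σ []      = refl
act≡⟦permute⟧ σ (t ∷ p) = cong (_ ∷_) (act≡⟦permute⟧ σ p)

module _ (σ : Permutation′ n) where

  private
    τ : Fin n → Fin n
    τ = σ ⟨$⟩ˡ_

    τ-== : ∀ i j → (τ i == τ j) ≡ (i == j)
    τ-== = ==-injective τ (⟨$⟩ʳ-injective (flip σ))

    ==-τ : ∀ a i → (σ ⟨$⟩ʳ a == i) ≡ (a == τ i)
    ==-τ a i = trans (cong (σ ⟨$⟩ʳ a ==_) (sym (inverseʳ σ)))
                     (==-injective (σ ⟨$⟩ʳ_) (⟨$⟩ʳ-injective σ) a (τ i))

  permute-var : ∀ i j → ⟦ permute σ ⟧ (var i j) ≋ var (τ i) (τ j)
  permute-var i j = term-cong refl λ a b → begin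
    symExp (varMon i j) (σ ⟨$⟩ʳ a) (σ ⟨$⟩ʳ b)
      ≡⟨ symExp-symmetric (varMon i j) (varMon-sym i j) (σ ⟨$⟩ʳ a) (σ ⟨$⟩ʳ b) ⟩
    varMon i j (σ ⟨$⟩ʳ a) (σ ⟨$⟩ʳ b)
      ≡⟨ 𝔹.if-cong (cong₂ _∨_ (cong₂ _∧_ (==-τ a i) (==-τ b j)) (cong₂ _∧_ (==-τ a j) (==-τ b i))) ⟩
    varMon (τ i) (τ j) a b
      ∎
    where open ≡-Reasoning

  permute-A : Relabels (permute σ) (flip σ) (A n) (A n)
  permute-A i j = begin
    ⟦ permute σ ⟧ (if i == j then diagA i else offA i j)   ≈⟨ entry (i == j) ⟩
    (if i == j then diagA (τ i) else offA (τ i) (τ j))     ≡⟨ 𝔹.if-cong (τ-== i j) ⟨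
    (if τ i == τ j then diagA (τ i) else offA (τ i) (τ j)) ∎
    where
    open ≋
    off : ⟦ permute σ ⟧ (offA i j) ≋ offA (τ i) (τ j)
    off = ⟦⟧-scaleP-≋ (permute σ) (ℚ.- 1ℚ) (var i j) (permute-var i j)
    diag-term : ∀ k → ⟦ permute σ ⟧ (if k == i then zeroP else var i k) ≋ (if τ k == τ i then zeroP else var (τ i) (τ k))
    diag-term k with k == i | τ k == τ i | τ-== k i
    ... | true  | .true  | refl = ≋.refl
    ... | false | .false | refl = permute-var i k
    diag : ⟦ permute σ ⟧ (diagA i) ≋ diagA (τ i)
    diag = begin
      ⟦ permute σ ⟧ (diagA i)                                                   ≡⟨ ⟦⟧-sumP (permute σ) _ (allFin n) ⟩
      sumP (map (λ k → ⟦ permute σ ⟧ (if k == i then zeroP else var i k)) (allFin n)) ≈⟨ sumP-cong diag-term (allFin n) ⟩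
      sumP (map (λ k → if τ k == τ i then zeroP else var (τ i) (τ k)) (allFin n))    ≈⟨ sumP-allFin-permute _ (flip σ) ⟨
      diagA (τ i)                                                               ∎
    entry : ∀ c → ⟦ permute σ ⟧ (if c then diagA i else offA i j) ≋ (if c then diagA (τ i) else offA (τ i) (τ j))
    entry true  = diag
    entry false = off

-- Setting the variables w_{i,n+1} to zero

data LastView {n} : Fin (suc n) → Set where
  last  : LastView (fromℕ n)
  inner : (i : Fin n) → LastView (inject₁ i)

lastView : (j : Fin (suc n)) → LastView j
lastView {zero}  Fin.zero    = last
lastView {suc n} Fin.zero    = inner Fin.zero
lastView {suc n} (Fin.suc j) with lastView j
... | last    = last
... | inner i = inner (Fin.suc i)

all-true-∈ : ∀ (P : X → Bool) {xs x} → ∧∑.∑ P xs ≡ true → x ∈ xs → P x ≡ true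
all-true-∈ P {y ∷ xs} all-P (here refl) = 𝔹.∧-conicalˡ (P y) _ all-P
all-true-∈ P {y ∷ xs} all-P (there x∈xs) = all-true-∈ P (𝔹.∧-conicalʳ (P y) _ all-P) x∈xs

all-false-∈ : ∀ (P : X → Bool) {xs x} → x ∈ xs → P x ≡ false → ∧∑.∑ P xs ≡ false
all-false-∈ P {xs} x∈xs Px with ∧∑.∑ P xs in all-P
... | true  with () ← trans (sym (all-true-∈ P all-P x∈xs)) Px
... | false = refl

+-≡ᵇ-0 : ∀ x y → (x ℕ.+ y ℕ.≡ᵇ 0) ≡ (x ℕ.≡ᵇ 0) ∧ (y ℕ.≡ᵇ 0)
+-≡ᵇ-0 zero    y = refl
+-≡ᵇ-0 (suc x) y = refl

restrict : (n : ℕ) → MonomialMap (suc n) n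
restrict n = record
  { keep            = lastColumnZero
  ; rename          = λ m i j → m (inject₁ i) (inject₁ j)
  ; keep-*ₘ         = λ m m′ → trans (∧∑.∑-cong (λ i → +-≡ᵇ-0 (m (inject₁ i) (fromℕ n)) _) (allFin n))
                                      (∧∑.∑-distrib _ _ (allFin n))
  ; rename-*ₘ       = λ _ _ _ _ → refl
  ; keep-one        = ∧∑.∑-identity (λ _ → refl) (allFin n)
  ; rename-totalDeg = λ m kept → totalDeg-restrict m λ i →
                        ℕₚ.≡ᵇ⇒≡ _ 0 (T-from (all-true-∈ (λ i → m (inject₁ i) (fromℕ n) ℕ.≡ᵇ 0) kept (∈-allFin i)))
  ; rename-one      = λ _ _ → refl
  }
  where
  lastColumnZero : Mon (suc n) → Bool
  lastColumnZero m = ∧∑.∑ (λ i → m (inject₁ i) (fromℕ n) ℕ.≡ᵇ 0) (allFin n)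

module _ {n : ℕ} where

  private
    ℓ : Fin (suc n)
    ℓ = fromℕ n

    ι==ℓ : ∀ i → (inject₁ i == ℓ) ≡ false
    ι==ℓ i = ==-≢ (fromℕ≢inject₁ {n} {i} ∘ sym)

    ℓ==ι : ∀ i → (ℓ == inject₁ i) ≡ false
    ℓ==ι i = ==-≢ (fromℕ≢inject₁ {n} {i})

  restrict-var : ∀ i j → ⟦ restrict n ⟧ (var (inject₁ i) (inject₁ j)) ≋ var i j
  restrict-var i j = ⟦⟧-kept (restrict n) (∧∑.∑-identity no-last (allFin n)) renamed
    where
    no-last : ∀ x → (varMon (inject₁ i) (inject₁ j) (inject₁ x) ℓ ℕ.≡ᵇ 0) ≡ true
    no-last x = cong (λ c → (if c then 1 else 0) ℕ.≡ᵇ 0)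
      (cong₂ _∨_ (trans (cong ((inject₁ x == inject₁ i) ∧_) (ℓ==ι j)) (𝔹.∧-zeroʳ (inject₁ x == inject₁ i)))
                 (trans (cong ((inject₁ x == inject₁ j) ∧_) (ℓ==ι i)) (𝔹.∧-zeroʳ (inject₁ x == inject₁ j))))
    ι== : ∀ x y → (inject₁ x == inject₁ y) ≡ (x == y)
    ι== = ==-injective inject₁ inject₁-injective
    renamed : ∀ x y → varMon (inject₁ i) (inject₁ j) (inject₁ x) (inject₁ y) ≡ varMon i j x y
    renamed x y = 𝔹.if-cong (cong₂ _∨_ (cong₂ _∧_ (ι== x i) (ι== y j)) (cong₂ _∧_ (ι== x j) (ι== y i)))

  restrict-var-killed : ∀ a b i → varMon a b (inject₁ i) ℓ ≡ 1 → ⟦ restrict n ⟧ (var a b) ≋ zeroP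
  restrict-var-killed a b i w≡1 = ≡⇒≋ (⟦⟧-killed (restrict n)
    (all-false-∈ (λ x → varMon a b (inject₁ x) ℓ ℕ.≡ᵇ 0) (∈-allFin i) (cong (ℕ._≡ᵇ 0) w≡1)))

  restrict-offA-killed : ∀ a b i → varMon a b (inject₁ i) ℓ ≡ 1 → ⟦ restrict n ⟧ (offA a b) ≋ zeroP
  restrict-offA-killed a b i w≡1 = ⟦⟧-scaleP-≋ (restrict n) (ℚ.- 1ℚ) (var a b) (restrict-var-killed a b i w≡1)

  varMon-ι-ℓ : ∀ i → varMon (inject₁ i) ℓ (inject₁ i) ℓ ≡ 1
  varMon-ι-ℓ i rewrite ==-refl (inject₁ i) | ==-refl ℓ = refl

  varMon-ℓ-ι : ∀ i → varMon ℓ (inject₁ i) (inject₁ i) ℓ ≡ 1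
  varMon-ℓ-ι i rewrite ==-refl (inject₁ i) | ==-refl ℓ = 𝔹.if-cong (𝔹.∨-zeroʳ ((inject₁ i == ℓ) ∧ (ℓ == inject₁ i)))

  restrict-A-last-column : ∀ i → ⟦ restrict n ⟧ (A (suc n) (inject₁ i) ℓ) ≋ zeroP
  restrict-A-last-column i rewrite ι==ℓ i = restrict-offA-killed (inject₁ i) ℓ i (varMon-ι-ℓ i)

  restrict-A-last-row : ∀ j → ⟦ restrict n ⟧ (A (suc n) ℓ j) ≋ zeroP
  restrict-A-last-row j with lastView j
  ... | inner i rewrite ℓ==ι i = restrict-offA-killed ℓ (inject₁ i) i (varMon-ℓ-ι i)
  ... | last    rewrite ==-refl ℓ = begin
    ⟦ restrict n ⟧ (diagA ℓ)
      ≡⟨ ⟦⟧-sumP (restrict n) (λ k → if k == ℓ then zeroP else var ℓ k) (allFin (suc n)) ⟩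
    sumP (map (λ k → ⟦ restrict n ⟧ (if k == ℓ then zeroP else var ℓ k)) (allFin (suc n)))
      ≈⟨ sumP-zero term↦0 (allFin (suc n)) ⟩
    zeroP
      ∎
    where
    open ≋
    term↦0 : ∀ k → ⟦ restrict n ⟧ (if k == ℓ then zeroP else var ℓ k) ≋ zeroP
    term↦0 k with lastView k
    ... | last    rewrite ==-refl ℓ = ≋.refl
    ... | inner i rewrite ι==ℓ i = restrict-var-killed ℓ (inject₁ i) i (varMon-ℓ-ι i)

  restrict-A : Restricts (restrict n) (A (suc n)) (A n)
  restrict-A i j = begin
    ⟦ restrict n ⟧ (if inject₁ i == inject₁ j then diagA (inject₁ i) else offA (inject₁ i) (inject₁ j))
      ≡⟨ cong (λ c → ⟦ restrict n ⟧ (if c then diagA (inject₁ i) else offA (inject₁ i) (inject₁ j))) (ι== i j) ⟩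
    ⟦ restrict n ⟧ (if i == j then diagA (inject₁ i) else offA (inject₁ i) (inject₁ j))
      ≈⟨ entry (i == j) ⟩
    (if i == j then diagA i else offA i j) ∎
    where
    open ≋
    ι== : ∀ x y → (inject₁ x == inject₁ y) ≡ (x == y)
    ι== = ==-injective inject₁ inject₁-injective
    diag-term : ∀ k → ⟦ restrict n ⟧ (if inject₁ k == inject₁ i then zeroP else var (inject₁ i) (inject₁ k))
                      ≋ (if k == i then zeroP else var i k)
    diag-term k rewrite ι== k i with k == i
    ... | true  = ≋.refl
    ... | false = restrict-var i k
    diag-terms : Fin (suc n) → Poly (suc n)
    diag-terms k = if k == inject₁ i then zeroP else var (inject₁ i) k
    last-term : ⟦ restrict n ⟧ (if ℓ == inject₁ i then zeroP else var (inject₁ i) ℓ) ≋ zeroP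
    last-term rewrite ℓ==ι i = restrict-var-killed (inject₁ i) ℓ i (varMon-ι-ℓ i)
    entry : ∀ c → ⟦ restrict n ⟧ (if c then diagA (inject₁ i) else offA (inject₁ i) (inject₁ j))
                  ≋ (if c then diagA i else offA i j)
    entry true  = ≋.trans (⟦⟧-sumP-allFin-last-zero (restrict n) diag-terms last-term) (sumP-cong diag-term (allFin n))
    entry false = ⟦⟧-scaleP-≋ (restrict n) (ℚ.- 1ℚ) (var (inject₁ i) (inject₁ j)) (restrict-var i j)

PreservesTraces : MonomialMap a b → Set
PreservesTraces {a} {b} f = ∀ k → ⟦ f ⟧ (trace (powM (A a) (suc k))) ≋ trace (powM (A b) (suc k))

permute-preservesTraces : (σ : Permutation′ n) → PreservesTraces (permute σ)
permute-preservesTraces {n} σ k = trace-relabels (permute σ) (flip σ) {powM (A n) (suc k)} {powM (A n) (suc k)}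
  (powM-relabels (permute σ) (flip σ) {A n} {A n} (permute-A σ) (suc k))

restrict-preservesTraces : PreservesTraces (restrict n)
restrict-preservesTraces {n} k = trace-restricts (restrict n) {powM (A (suc n)) (suc k)} {powM (A n) (suc k)}
  (powM-restricts (restrict n) {A (suc n)} {A n} restrict-A restrict-A-last-column (suc k))
  (·M-last-row↦0 (restrict n) {A (suc n)} (powM (A (suc n)) k) restrict-A-last-row (fromℕ n))

-- R g n is homPart (2 ℕ.* g) (expTrunc g (rTrunc g n))
expTrunc : ℕ → Poly n → Poly n
expTrunc g X = sumP (map (λ k → scaleP (invℕ (k !)) (powP X k)) (upTo (suc g)))

module _ (f : MonomialMap a b) where

  ⟦⟧-linear-combination : ∀ (c : X → ℚ) (F : X → Poly a) (G : X → Poly b) → (∀ x → ⟦ f ⟧ (F x) ≋ G x) →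
    ∀ xs → ⟦ f ⟧ (sumP (map (λ x → scaleP (c x) (F x)) xs)) ≋ sumP (map (λ x → scaleP (c x) (G x)) xs)
  ⟦⟧-linear-combination c F G F↦G xs = ≋.trans (≡⇒≋ (⟦⟧-sumP f (λ x → scaleP (c x) (F x)) xs))
    (sumP-cong (λ x → ⟦⟧-scaleP-≋ f (c x) (F x) (F↦G x)) xs)

  module _ (traces : PreservesTraces f) (g : ℕ) where

    -- 2 ℕ.* suc h reduces to suc (h ℕ.+ 1 ℕ.* suc h)
    ⟦⟧-rTrunc : ⟦ f ⟧ (rTrunc g a) ≋ rTrunc g b
    ⟦⟧-rTrunc = ⟦⟧-linear-combination (λ h → rCoeff (suc h)) (λ h → trace (powM (A a) (2 ℕ.* suc h)))
                  (λ h → trace (powM (A b) (2 ℕ.* suc h))) (λ h → traces (h ℕ.+ 1 ℕ.* suc h)) (upTo g)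

    ⟦⟧-r : ⟦ f ⟧ (r g a) ≋ r g b
    ⟦⟧-r = ≋.trans (≡⇒≋ (⟦⟧-homPart f (2 ℕ.* g) (rTrunc g a))) (homPart-cong (2 ℕ.* g) ⟦⟧-rTrunc)

    ⟦⟧-R : ⟦ f ⟧ (R g a) ≋ R g b
    ⟦⟧-R = ≋.trans (≡⇒≋ (⟦⟧-homPart f (2 ℕ.* g) (expTrunc g (rTrunc g a)))) (homPart-cong (2 ℕ.* g) ⟦⟧-expTrunc)
      where
      ⟦⟧-expTrunc : ⟦ f ⟧ (expTrunc g (rTrunc g a)) ≋ expTrunc g (rTrunc g b)
      ⟦⟧-expTrunc = ⟦⟧-linear-combination (λ k → invℕ (k !)) (powP (rTrunc g a)) (powP (rTrunc g b))
        (λ k → ≋.trans (⟦⟧-powP f (rTrunc g a) k) (powP-cong ⟦⟧-rTrunc k)) (upTo (suc g))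

InW-of-natural : ∀ (P : (n : ℕ) → Poly n) d →
  (∀ {a b} (f : MonomialMap a b) → PreservesTraces f → ⟦ f ⟧ (P a) ≋ P b) →
  (∀ n (m : Mon n) → d < totalDeg m → coeff (P n) m ≡ 0ℚ) →
  InW P
InW-of-natural P d natural bounded =
  ( (λ n _ σ → coeff-≡ (≋.trans (≡⇒≋ (act≡⟦permute⟧ σ (P n))) (natural (permute σ) (permute-preservesTraces σ))))
  , (d , λ n _ → bounded n)
  , (λ n _ → coeff-≡ (natural (restrict n) restrict-preservesTraces)) )

proposition1 : (g : ℕ) → InW (R g) × InW (r g)
proposition1 g =
    InW-of-natural (R g) (2 ℕ.* g) (λ f traces → ⟦⟧-R f traces g)
                   (λ n → coeff-homPart-above (2 ℕ.* g) (expTrunc g (rTrunc g n)))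
  , InW-of-natural (r g) (2 ℕ.* g) (λ f traces → ⟦⟧-r f traces g)
                   (λ n → coeff-homPart-above (2 ℕ.* g) (rTrunc g n))
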